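{- Let $n\ge 1$ be an integer and let $M(P_n)$ be the middle graph of the path $P_n$ on $n$ vertices. Then $$\operatorname{rn}(M(P_n))=\begin{cases}4k^2-1, & \text{if } n=2k,\\ 4k(k+1), & \text{if } n=2k+1.\end{cases}$$
   Context: For a graph $G$, the middle graph $M(G)$ is the graph with vertex set $V(G)\cup E(G)$ in which two vertices are adjacent if and only if either they are adjacent edges of $G$, or one is a vertex of $G$ and the other is an edge of $G$ incident to it. For a connected graph $G$ with diameter $\operatorname{diam}(G)$ and distance function $d(u,v)$, a radio labeling of $G$ is a map $\varphi:V(G)\to\{0,1,2,\dots\}$ such that $|\varphi(u)-\varphi(v)|\ge \operatorname{diam}(G)+1-d(u,v)$ for every pair of distinct vertices $u,v$. The span of $\varphi$ is $\max\{|\varphi(u)-\varphi(v)|: u,v\in V(G)\}$, and the radio number $\operatorname{rn}(G)$ is the minimum span over all radio labelings of $G$. -}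

module Defs where

open import Data.Nat using (ℕ; zero; suc; _≤_; _+_; ∣_-_∣; _∸_)
open import Data.Fin using (Fin; toℕ)
open import Data.Sum using (_⊎_; inj₁; inj₂)
open import Data.Product using (Σ; _×_; _,_; ∃; ∃-syntax)
open import Data.Empty using (⊥)
open import Relation.Nullary using (¬_)
open import Relation.Binary.PropositionalEquality using (_≡_; _≢_)

record IncGraph : Set₁ where
  field
    Vtx : Set
    Edge : Set
    Inc : Vtx → Edge → Set

record SimpleGraph : Set₁ where
  field
    V : Set
    Adj : V → V → Set

open SimpleGraph public

pathGraph : ℕ → IncGraph
pathGraph n = record
  { Vtx = Fin n
  ; Edge = Fin (n ∸ 1)
  ; Inc = λ v e → (toℕ v ≡ toℕ e) ⊎ (toℕ v ≡ suc (toℕ e))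
  }

middleGraph : IncGraph → SimpleGraph
middleGraph G = record
  { V = Vtx ⊎ Edge
  ; Adj = adj
  }
  where
  open IncGraph G
  adj : Vtx ⊎ Edge → Vtx ⊎ Edge → Set
  adj (inj₁ _) (inj₁ _) = ⊥
  adj (inj₁ v) (inj₂ e) = Inc v e
  adj (inj₂ e) (inj₁ v) = Inc v e
  adj (inj₂ e) (inj₂ f) = (e ≢ f) × (∃[ v ] (Inc v e × Inc v f))

data Walk (G : SimpleGraph) : V G → V G → ℕ → Set where
  here : ∀ {u} → Walk G u u 0
  step : ∀ {u w v k} → Adj G u w → Walk G w v k → Walk G u v (suc k)

IsDist : (G : SimpleGraph) → V G → V G → ℕ → Set
IsDist G u v k = Walk G u v k × (∀ j → Walk G u v j → k ≤ j)

IsDiam : SimpleGraph → ℕ → Set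
IsDiam G D =
  (∀ u v → ∃[ k ] IsDist G u v k)
  × (∀ u v k → IsDist G u v k → k ≤ D)
  × (∃[ u ] ∃[ v ] IsDist G u v D)

IsRadioLabeling : (G : SimpleGraph) → ℕ → (V G → ℕ) → Set
IsRadioLabeling G D φ =
  ∀ u v → u ≢ v → ∀ k → IsDist G u v k → suc D ≤ ∣ φ u - φ v ∣ + k

IsSpan : (G : SimpleGraph) → (V G → ℕ) → ℕ → Set
IsSpan G φ s = (∀ u v → ∣ φ u - φ v ∣ ≤ s) × (∃[ u ] ∃[ v ] (∣ φ u - φ v ∣ ≡ s))

IsRadioNumber : SimpleGraph → ℕ → Set
IsRadioNumber G r =
  Σ ℕ λ D → IsDiam G D
    × (∃[ φ ] (IsRadioLabeling G D φ × IsSpan G φ r))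
    × (∀ φ → IsRadioLabeling G D φ → ∀ s → IsSpan G φ s → r ≤ s)

module Submission where

-- Encode the elements of M(P_n) as subintervals of [0, n]; the distance of two
-- distinct elements is then the largest gap between the end of one and the start of the
-- other, so the diameter is n. Weight each element x by w(x), twice the distance from the
-- centre n/2 of the path to the far end of x. Then 2 d(x, y) ≤ w(x) + w(y), and the 2n - 1
-- weights add up to n². Listing the elements by increasing label of a radio labeling, each
-- consecutive pair gives φ(y) - φ(x) ≥ n + 1 - (w(x) + w(y))/2; summing over the 2n - 2
-- pairs yields a span of at least (2n - 2)(n + 1) - n² + (w(first) + w(last))/2 ≥ n² - 1.
-- Conversely, start at the central element and then run periodically through two elements
-- near the left end and two near the right end of the path: with gaps of about n/2 every
-- consecutive pair satisfies the radio condition and any two consecutive gaps add up to at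
-- least n, so every other pair does as well, and the span is exactly n² - 1.

open import Defs
open import Data.Nat using (ℕ; zero; suc; _≤_; _<_; _+_; _*_; _∸_; _⊔_; z≤n; s≤s; s≤s⁻¹; ∣_-_∣; _≟_; _≤?_)
open import Data.Nat.Properties
open import Data.Nat.Tactic.RingSolver using (solve-∀)
open import Data.Sum using (_⊎_; inj₁; inj₂)
open import Data.Product using (Σ; _×_; _,_; ∃-syntax; proj₂)
open import Data.Empty using (⊥-elim)
open import Data.Fin as Fin using (Fin; toℕ; fromℕ<)
import Data.Fin.Properties as Finₚ
open import Data.Sum.Properties using (inj₁-injective; inj₂-injective; ≡-dec)
open import Relation.Binary using (tri<; tri≈; tri>)
open import Function using (_∘_)
open import Data.List using (List; []; _∷_; _++_; length; map; tabulate)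
open import Data.List.Properties using (map-++; map-tabulate; length-++; length-tabulate)
open import Data.List.Membership.Propositional using (_∈_)
open import Data.List.Membership.Propositional.Properties using (∈-tabulate⁻)
import Data.List.Relation.Unary.All as All
open import Data.List.Relation.Unary.Any using (here; there)
open import Data.List.Relation.Unary.Unique.Propositional using (Unique)
import Data.List.Relation.Unary.Unique.Propositional.Properties as Unique
import Data.List.Relation.Unary.AllPairs as AllPairs
import Data.List.Relation.Unary.Linked as Linked
open import Data.List.Relation.Unary.Linked.Properties using (AllPairs⇒Linked)
open import Data.List.Relation.Binary.Permutation.Propositional using (_↭_; ↭-sym; ↭⇒↭ₛ)
open import Data.List.Relation.Binary.Permutation.Propositional.Properties using (↭-length)
import Data.List.Relation.Binary.Permutation.Propositional.Properties as Perm
import Data.List.Relation.Binary.Permutation.Setoid.Properties as PermSetoid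
import Data.List.Sort as Sort
import Relation.Binary.Construct.On as On
open import Data.List.Relation.Unary.Linked using (Linked; [-]; _∷_)
open import Data.Nat.ListAction using (sum)
open import Data.Nat.ListAction.Properties using (sum-++; sum-↭)
open import Relation.Binary.PropositionalEquality
open import Relation.Nullary using (¬_; yes; no)

sumBelow : ℕ → (ℕ → ℕ) → ℕ
sumBelow zero    f = 0
sumBelow (suc p) f = f 0 + sumBelow p (f ∘ suc)

sumBelow-suc : ∀ p f → sumBelow (suc p) f ≡ sumBelow p f + f p
sumBelow-suc zero    f = +-comm (f 0) 0
sumBelow-suc (suc p) f =
  trans (cong (f 0 +_) (sumBelow-suc p (f ∘ suc))) (sym (+-assoc (f 0) _ _))

sumBelow-+ : ∀ p q f → sumBelow (p + q) f ≡ sumBelow p f + sumBelow q (λ i → f (p + i))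
sumBelow-+ zero    q f = refl
sumBelow-+ (suc p) q f = trans (cong (f 0 +_) (sumBelow-+ p q (f ∘ suc))) (sym (+-assoc (f 0) _ _))

sumBelow-cong : ∀ p {f g : ℕ → ℕ} → (∀ i → f i ≡ g i) → sumBelow p f ≡ sumBelow p g
sumBelow-cong zero    eq = refl
sumBelow-cong (suc p) eq = cong₂ _+_ (eq 0) (sumBelow-cong p (eq ∘ suc))

sumBelow-suc-pointwise : ∀ p f → sumBelow p (suc ∘ f) ≡ p + sumBelow p f
sumBelow-suc-pointwise zero    f = refl
sumBelow-suc-pointwise (suc p) f = cong suc (begin
  f 0 + sumBelow p (suc ∘ f ∘ suc) ≡⟨ cong (f 0 +_) (sumBelow-suc-pointwise p (f ∘ suc)) ⟩
  f 0 + (p + sumBelow p (f ∘ suc)) ≡⟨ +-comm-middle (f 0) p _ ⟩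
  p + (f 0 + sumBelow p (f ∘ suc)) ∎)
  where
  open ≡-Reasoning
  +-comm-middle : ∀ a b c → a + (b + c) ≡ b + (a + c)
  +-comm-middle = solve-∀

sumBelow-monoˡ : ∀ {p q} f → p ≤ q → sumBelow p f ≤ sumBelow q f
sumBelow-monoˡ {q = zero}  f z≤n = ≤-refl
sumBelow-monoˡ {p} {suc q} f p≤1+q with m≤n⇒m<n∨m≡n p≤1+q
... | inj₂ refl = ≤-refl
... | inj₁ p<1+q = begin
  sumBelow p f        ≤⟨ sumBelow-monoˡ f (≤-pred p<1+q) ⟩
  sumBelow q f        ≤⟨ m≤m+n _ (f q) ⟩
  sumBelow q f + f q  ≡⟨ sumBelow-suc q f ⟨
  sumBelow (suc q) f  ∎
  where open ≤-Reasoning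

sum-tabulate-toℕ : ∀ p (g : ℕ → ℕ) → sum (tabulate {n = p} (g ∘ toℕ)) ≡ sumBelow p g
sum-tabulate-toℕ zero    g = refl
sum-tabulate-toℕ (suc p) g = cong (g 0 +_) (sum-tabulate-toℕ p (g ∘ suc))

oddOffsetSum : ℕ → ℕ
oddOffsetSum p = sumBelow p (λ i → ∣ p - suc (2 * i) ∣)

oddOffsetSum-2+ : ∀ p → oddOffsetSum (2 + p) ≡ suc p + oddOffsetSum p + suc p
oddOffsetSum-2+ p = begin
  oddOffsetSum (2 + p)                                 ≡⟨ cong (suc p +_) (sumBelow-suc p (offset ∘ suc)) ⟩
  suc p + (sumBelow p (offset ∘ suc) + offset (suc p)) ≡⟨ cong₂ (λ a b → suc p + (a + b)) inner last ⟩
  suc p + (oddOffsetSum p + suc p)                     ≡⟨ +-assoc (suc p) _ _ ⟨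
  suc p + oddOffsetSum p + suc p                       ∎
  where
  open ≡-Reasoning
  offset : ℕ → ℕ
  offset i = ∣ 2 + p - suc (2 * i) ∣
  inner : sumBelow p (offset ∘ suc) ≡ oddOffsetSum p
  inner = sumBelow-cong p (λ i → cong (λ x → ∣ 2 + p - suc x ∣) (*-suc 2 i))
  last : offset (suc p) ≡ suc p
  last = begin
    ∣ 2 + p - suc (2 * suc p) ∣ ≡⟨ cong (λ x → ∣ 2 + p - suc x ∣) (*-suc 2 p) ⟩
    ∣ p - suc (2 * p) ∣         ≡⟨ cong (λ x → ∣ p - x ∣) (+-suc p (p + 0)) ⟨
    ∣ p - p + suc (p + 0) ∣     ≡⟨ ∣m-m+n∣≡n p _ ⟩
    suc (p + 0)                 ≡⟨ cong suc (+-identityʳ p) ⟩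
    suc p                       ∎

oddOffsetSum-consecutive : ∀ p → oddOffsetSum p + oddOffsetSum (suc p) ≡ p * suc p
oddOffsetSum-consecutive zero    = refl
oddOffsetSum-consecutive (suc p) = begin
  oddOffsetSum (suc p) + oddOffsetSum (2 + p)                 ≡⟨ cong (oddOffsetSum (suc p) +_) (oddOffsetSum-2+ p) ⟩
  oddOffsetSum (suc p) + (suc p + oddOffsetSum p + suc p)     ≡⟨ regroup (oddOffsetSum (suc p)) (oddOffsetSum p) p ⟩
  (oddOffsetSum p + oddOffsetSum (suc p)) + 2 * suc p         ≡⟨ cong (_+ 2 * suc p) (oddOffsetSum-consecutive p) ⟩
  p * suc p + 2 * suc p                                       ≡⟨ close p ⟩
  suc p * suc (suc p)                                         ∎
  where
  open ≡-Reasoning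
  regroup : ∀ a b p → a + (suc p + b + suc p) ≡ (b + a) + 2 * suc p
  regroup = solve-∀
  close : ∀ p → p * suc p + 2 * suc p ≡ suc p * suc (suc p)
  close = solve-∀

m∸n⊔n∸m≡∣m-n∣ : ∀ m n → (m ∸ n) ⊔ (n ∸ m) ≡ ∣ m - n ∣
m∸n⊔n∸m≡∣m-n∣ zero    n       = cong (_⊔ n) (0∸n≡0 n)
m∸n⊔n∸m≡∣m-n∣ (suc m) zero    = ⊔-identityʳ (suc m)
m∸n⊔n∸m≡∣m-n∣ (suc m) (suc n) = m∸n⊔n∸m≡∣m-n∣ m n

m∸n⊔2+n∸m≡1+∣m-1+n∣ : ∀ m n → (m ∸ n) ⊔ (2 + n ∸ m) ≡ suc ∣ m - suc n ∣
m∸n⊔2+n∸m≡1+∣m-1+n∣ zero    n       = cong (_⊔ (2 + n)) (0∸n≡0 n)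
m∸n⊔2+n∸m≡1+∣m-1+n∣ (suc m) zero    =
  trans (m≥n⇒m⊔n≡m (≤-trans (m∸n≤m 1 m) (s≤s z≤n))) (cong suc (sym (∣-∣-identityʳ m)))
m∸n⊔2+n∸m≡1+∣m-1+n∣ (suc m) (suc n) = m∸n⊔2+n∸m≡1+∣m-1+n∣ m n

∸-triangle : ∀ a b c → a ∸ c ≤ (a ∸ b) + (b ∸ c)
∸-triangle a b c = m≤n+o⇒m∸n≤o a c (begin
  a                         ≤⟨ m≤n+m∸n a b ⟩
  b + (a ∸ b)               ≤⟨ +-monoˡ-≤ (a ∸ b) (m≤n+m∸n b c) ⟩
  c + (b ∸ c) + (a ∸ b)     ≡⟨ regroup c (b ∸ c) (a ∸ b) ⟩
  c + ((a ∸ b) + (b ∸ c))   ∎)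
  where
  open ≤-Reasoning
  regroup : ∀ x y z → x + y + z ≡ x + (z + y)
  regroup = solve-∀

-- Vertex i of the path is the interval [i, i + 1] and the edge {j, j + 1} is the point j + 1.
Node : Set
Node = ℕ ⊎ ℕ

lo hi : Node → ℕ
lo (inj₁ i) = i
lo (inj₂ j) = suc j
hi (inj₁ i) = suc i
hi (inj₂ j) = suc j

lo≤hi : ∀ x → lo x ≤ hi x
lo≤hi (inj₁ i) = n≤1+n i
lo≤hi (inj₂ j) = ≤-refl

nodeDist : Node → Node → ℕ
nodeDist x y = (hi y ∸ lo x) ⊔ (hi x ∸ lo y)

nodeDist-comm : ∀ x y → nodeDist x y ≡ nodeDist y x
nodeDist-comm x y = ⊔-comm (hi y ∸ lo x) (hi x ∸ lo y)

shift : Node → Node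
shift (inj₁ i) = inj₁ (suc i)
shift (inj₂ j) = inj₂ (suc j)

nodeDist-shift : ∀ x y → nodeDist (shift x) (shift y) ≡ nodeDist x y
nodeDist-shift (inj₁ _) (inj₁ _) = refl
nodeDist-shift (inj₁ _) (inj₂ _) = refl
nodeDist-shift (inj₂ _) (inj₁ _) = refl
nodeDist-shift (inj₂ _) (inj₂ _) = refl

-- Twice the distance from the centre n/2 to the far end of x.
weight : ℕ → Node → ℕ
weight n x = (n ∸ 2 * lo x) ⊔ (2 * hi x ∸ n)

2*nodeDist≤weight+weight : ∀ n x y → 2 * nodeDist x y ≤ weight n x + weight n y
2*nodeDist≤weight+weight n x y = begin
  2 * nodeDist x y                              ≡⟨ *-distribˡ-⊔ 2 (hi y ∸ lo x) (hi x ∸ lo y) ⟩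
  2 * (hi y ∸ lo x) ⊔ 2 * (hi x ∸ lo y)         ≤⟨ ⊔-lub (gap x y) (≤-trans (gap y x) (≤-reflexive (+-comm (weight n y) _))) ⟩
  weight n x + weight n y                       ∎
  where
  open ≤-Reasoning
  gap : ∀ x y → 2 * (hi y ∸ lo x) ≤ weight n x + weight n y
  gap x y = begin
    2 * (hi y ∸ lo x)                     ≡⟨ *-distribˡ-∸ 2 (hi y) (lo x) ⟩
    2 * hi y ∸ 2 * lo x                   ≤⟨ ∸-triangle (2 * hi y) n (2 * lo x) ⟩
    (2 * hi y ∸ n) + (n ∸ 2 * lo x)       ≤⟨ +-mono-≤ (m≤n⊔m (n ∸ 2 * lo y) _) (m≤m⊔n _ (2 * hi x ∸ n)) ⟩
    weight n y + weight n x               ≡⟨ +-comm (weight n y) _ ⟩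
    weight n x + weight n y               ∎

weight-vertex : ∀ n i → weight n (inj₁ i) ≡ suc ∣ n - suc (2 * i) ∣
weight-vertex n i = trans (cong (λ x → (n ∸ 2 * i) ⊔ (x ∸ n)) (*-suc 2 i)) (m∸n⊔2+n∸m≡1+∣m-1+n∣ n (2 * i))

weight-edge : ∀ m j → weight (2 + m) (inj₂ j) ≡ ∣ suc m - suc (2 * j) ∣
weight-edge m j = trans (m∸n⊔n∸m≡∣m-n∣ (2 + m) (2 * suc j)) (cong (λ x → ∣ 2 + m - x ∣) (*-suc 2 j))

lastOf : {A : Set} → A → List A → A
lastOf x []       = x
lastOf x (y ∷ ys) = lastOf y ys

lastOf-∈ : {A : Set} (x : A) (xs : List A) → lastOf x xs ∈ x ∷ xs
lastOf-∈ x []       = here refl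
lastOf-∈ x (y ∷ ys) = there (lastOf-∈ y ys)

module _ {A : Set} (φ w : A → ℕ) (c : ℕ) where

  telescope : ∀ {x xs} → Linked (λ a b → c + 2 * φ a ≤ 2 * φ b + (w a + w b)) (x ∷ xs) →
              length xs * c + 2 * φ x + w x + w (lastOf x xs) ≤ 2 * φ (lastOf x xs) + 2 * sum (map w (x ∷ xs))
  telescope {x} {[]}     [-]          = ≤-reflexive (single (φ x) (w x))
    where
    single : ∀ f v → 2 * f + v + v ≡ 2 * f + 2 * (v + 0)
    single = solve-∀
  telescope {x} {y ∷ ys} (x→y ∷ rest) = begin
    suc L * c + 2 * φ x + w x + w l                  ≡⟨ split c L (φ x) (w x) (w l) ⟩
    (c + 2 * φ x) + (L * c + w x + w l)              ≤⟨ +-monoˡ-≤ (L * c + w x + w l) x→y ⟩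
    (2 * φ y + (w x + w y)) + (L * c + w x + w l)    ≡⟨ regroup (φ y) (w x) (w y) (L * c) (w l) ⟩
    (L * c + 2 * φ y + w y + w l) + 2 * w x          ≤⟨ +-monoˡ-≤ (2 * w x) (telescope rest) ⟩
    (2 * φ l + 2 * S) + 2 * w x                      ≡⟨ collect (φ l) S (w x) ⟩
    2 * φ l + 2 * (w x + S)                          ∎
    where
    open ≤-Reasoning
    L = length ys
    l = lastOf y ys
    S = sum (map w (y ∷ ys))
    split : ∀ c L f a e → suc L * c + 2 * f + a + e ≡ (c + 2 * f) + (L * c + a + e)
    split = solve-∀
    regroup : ∀ f a b Lc e → 2 * f + (a + b) + (Lc + a + e) ≡ Lc + 2 * f + b + e + 2 * a
    regroup = solve-∀
    collect : ∀ f s a → 2 * f + 2 * s + 2 * a ≡ 2 * f + 2 * (a + s)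
    collect = solve-∀

module _ {G : SimpleGraph} where

  _▷_ : ∀ {u v w k} → Walk G u v k → Adj G v w → Walk G u w (suc k)
  here       ▷ a = step a here
  step b r   ▷ a = step b (r ▷ a)

  reverseWalk : (∀ {u v} → Adj G u v → Adj G v u) → ∀ {u v k} → Walk G u v k → Walk G v u k
  reverseWalk sym-adj here       = here
  reverseWalk sym-adj (step a r) = reverseWalk sym-adj r ▷ sym-adj a

  IsDist-unique : ∀ {u v j k} → IsDist G u v j → IsDist G u v k → j ≡ k
  IsDist-unique (wj , minj) (wk , mink) = ≤-antisym (minj _ wk) (mink _ wj)

  IsDist-sym : (∀ {u v} → Adj G u v → Adj G v u) → ∀ {u v k} → IsDist G u v k → IsDist G v u k
  IsDist-sym sym-adj (w , minimal) = reverseWalk sym-adj w , λ j w′ → minimal j (reverseWalk sym-adj w′)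

module MiddlePath (m : ℕ) where

  n : ℕ
  n = 2 + m

  M : SimpleGraph
  M = middleGraph (pathGraph n)

  Elt : Set
  Elt = Fin n ⊎ Fin (suc m)

  node : Elt → Node
  node (inj₁ i) = inj₁ (toℕ i)
  node (inj₂ j) = inj₂ (toℕ j)

  node-injective : ∀ {u v} → node u ≡ node v → u ≡ v
  node-injective {inj₁ _} {inj₁ _} eq = cong inj₁ (Finₚ.toℕ-injective (inj₁-injective eq))
  node-injective {inj₂ _} {inj₂ _} eq = cong inj₂ (Finₚ.toℕ-injective (inj₂-injective eq))

  dist : Elt → Elt → ℕ
  dist u v = nodeDist (node u) (node v)

  Incident : Fin n → Fin (suc m) → Set
  Incident = IncGraph.Inc (pathGraph n)

  incident-lo : ∀ {v e} → Incident v e → toℕ e ≤ toℕ v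
  incident-lo (inj₁ v≡e)  = ≤-reflexive (sym v≡e)
  incident-lo (inj₂ v≡1+e) = ≤-trans (n≤1+n _) (≤-reflexive (sym v≡1+e))

  incident-hi : ∀ {v e} → Incident v e → toℕ v ≤ suc (toℕ e)
  incident-hi (inj₁ v≡e)   = ≤-trans (≤-reflexive v≡e) (n≤1+n _)
  incident-hi (inj₂ v≡1+e) = ≤-reflexive v≡1+e

  adj-sym : ∀ {u w} → Adj M u w → Adj M w u
  adj-sym {inj₁ _} {inj₂ _} a = a
  adj-sym {inj₂ _} {inj₁ _} a = a
  adj-sym {inj₂ _} {inj₂ _} (e≢f , v , ve , vf) = (λ f≡e → e≢f (sym f≡e)) , v , vf , ve

  adj-hi≤1+lo : ∀ {u w} → Adj M u w → hi (node w) ≤ suc (lo (node u))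
  adj-hi≤1+lo {inj₁ _} {inj₂ _} ie              = s≤s (incident-lo ie)
  adj-hi≤1+lo {inj₂ _} {inj₁ _} ie              = s≤s (incident-hi ie)
  adj-hi≤1+lo {inj₂ _} {inj₂ _} (_ , _ , ve , vf) = s≤s (≤-trans (incident-lo vf) (incident-hi ve))

  walk-hi≤lo : ∀ {u v k} → Walk M u v (suc k) → hi (node v) ≤ suc k + lo (node u)
  walk-hi≤lo {u} (step {w = w} a here) = adj-hi≤1+lo {u} {w} a
  walk-hi≤lo {u} {v} {suc k} (step {w = w} a r@(step _ _)) = begin
    hi (node v)                 ≤⟨ walk-hi≤lo {w} {v} r ⟩
    suc k + lo (node w)         ≤⟨ +-monoʳ-≤ (suc k) (≤-trans (lo≤hi (node w)) (adj-hi≤1+lo {u} {w} a)) ⟩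
    suc k + suc (lo (node u))   ≡⟨ +-suc (suc k) _ ⟩
    suc (suc k) + lo (node u)   ∎
    where open ≤-Reasoning

  dist≤walk : ∀ {u v k} → u ≢ v → Walk M u v k → dist u v ≤ k
  dist≤walk {k = zero}  u≢u here = ⊥-elim (u≢u refl)
  dist≤walk {u} {v} {suc k} u≢v w = ⊔-lub (spread w) (spread (reverseWalk (λ {x} {y} → adj-sym {x} {y}) w))
    where
    spread : ∀ {x y} → Walk M x y (suc k) → hi (node y) ∸ lo (node x) ≤ suc k
    spread {x} {y} w = m≤n+o⇒m∸n≤o _ (lo (node x)) (≤-trans (walk-hi≤lo {x} {y} w) (≤-reflexive (+-comm (suc k) _)))

  edge-edge-adj : (e f : Fin (suc m)) → toℕ f ≡ suc (toℕ e) → Adj M (inj₂ e) (inj₂ f)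
  edge-edge-adj e f f≡1+e =
    (λ e≡f → 1+n≢n (trans (sym f≡1+e) (cong toℕ (sym e≡f)))) , Fin.suc e , inj₂ refl , inj₁ (sym f≡1+e)

  index-bound : ∀ {p} (f : Fin p) {a d} → toℕ f ≡ a + d → a < p
  index-bound f {a} {d} f≡ = ≤-trans (s≤s (≤-trans (m≤m+n a d) (≤-reflexive (sym f≡)))) (Finₚ.toℕ<n f)

  edgeWalk : ∀ d (e f : Fin (suc m)) → toℕ f ≡ toℕ e + d → Walk M (inj₂ e) (inj₂ f) d
  edgeWalk zero    e f f≡ =
    subst (λ g → Walk M (inj₂ e) (inj₂ g) 0) (Finₚ.toℕ-injective (sym (trans f≡ (+-identityʳ _)))) here
  edgeWalk (suc d) e f f≡ = step (edge-edge-adj e e′ e′≡) (edgeWalk d e′ f (trans f≡′ (cong (_+ d) (sym e′≡))))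
    where
    f≡′ : toℕ f ≡ suc (toℕ e) + d
    f≡′ = trans f≡ (+-suc (toℕ e) d)
    e′ : Fin (suc m)
    e′ = fromℕ< (index-bound f f≡′)
    e′≡ : toℕ e′ ≡ suc (toℕ e)
    e′≡ = Finₚ.toℕ-fromℕ< (index-bound f f≡′)

  edgeVertexWalk : ∀ d (e : Fin (suc m)) (j : Fin n) → toℕ j ≡ suc (toℕ e + d) → Walk M (inj₂ e) (inj₁ j) (suc d)
  edgeVertexWalk d e (Fin.suc j) j≡ = edgeWalk d e j (suc-injective j≡) ▷ inj₂ refl

  rightEdge : (i : Fin n) → toℕ i < suc m → Σ (Fin (suc m)) λ e → toℕ e ≡ toℕ i × Adj M (inj₁ i) (inj₂ e)
  rightEdge i i<1+m = fromℕ< i<1+m , Finₚ.toℕ-fromℕ< i<1+m , inj₁ (sym (Finₚ.toℕ-fromℕ< i<1+m))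

  vertexEdgeWalk : ∀ d (i : Fin n) (f : Fin (suc m)) → toℕ f ≡ toℕ i + d → Walk M (inj₁ i) (inj₂ f) (suc d)
  vertexEdgeWalk d i f f≡ with rightEdge i (index-bound f f≡)
  ... | e , e≡i , i-e = step i-e (edgeWalk d e f (trans f≡ (cong (_+ d) (sym e≡i))))

  vertexWalk : ∀ d (i j : Fin n) → toℕ j ≡ suc (toℕ i + d) → Walk M (inj₁ i) (inj₁ j) (2 + d)
  vertexWalk d i j j≡ with rightEdge i (s≤s⁻¹ (index-bound j j≡))
  ... | e , e≡i , i-e = step i-e (edgeVertexWalk d e j (trans j≡ (cong (λ x → suc (x + d)) (sym e≡i))))

  isDist-of-walk : ∀ {u v k} → u ≢ v → Walk M u v k → hi (node v) ≡ lo (node u) + k → IsDist M u v (dist u v)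
  isDist-of-walk {u} {v} {k} u≢v w hi≡ = subst (Walk M u v) (sym dist≡k) w , λ j → dist≤walk u≢v
    where
    dist≡k : dist u v ≡ k
    dist≡k = ≤-antisym (dist≤walk u≢v w)
      (≤-trans (≤-reflexive (sym (trans (cong (_∸ lo (node u)) hi≡) (m+n∸m≡n (lo (node u)) k)))) (m≤m⊔n _ _))

  isDist-flip : ∀ {u v} → IsDist M v u (dist v u) → IsDist M u v (dist u v)
  isDist-flip {u} {v} d = subst (IsDist M u v) (nodeDist-comm (node v) (node u)) (IsDist-sym (λ {x} {y} → adj-sym {x} {y}) d)

  vertex-vertex-distance : ∀ {i j} → toℕ i < toℕ j → IsDist M (inj₁ i) (inj₁ j) (dist (inj₁ i) (inj₁ j))
  vertex-vertex-distance {i} {j} i<j =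
    isDist-of-walk (λ i≡j → <-irrefl (cong toℕ (inj₁-injective i≡j)) i<j) (vertexWalk _ i j j≡)
      (trans (cong suc j≡) (sym (trans (+-suc (toℕ i) _) (cong suc (+-suc (toℕ i) _)))))
    where
    j≡ = sym (m+[n∸m]≡n i<j)

  vertex-edge-distance : ∀ {i f} → toℕ i ≤ toℕ f → IsDist M (inj₁ i) (inj₂ f) (dist (inj₁ i) (inj₂ f))
  vertex-edge-distance {i} {f} i≤f =
    isDist-of-walk (λ ()) (vertexEdgeWalk _ i f f≡) (trans (cong suc f≡) (sym (+-suc (toℕ i) _)))
    where
    f≡ = sym (m+[n∸m]≡n i≤f)

  edge-vertex-distance : ∀ {e j} → toℕ e < toℕ j → IsDist M (inj₂ e) (inj₁ j) (dist (inj₂ e) (inj₁ j))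
  edge-vertex-distance {e} {j} e<j =
    isDist-of-walk (λ ()) (edgeVertexWalk _ e j j≡) (cong suc (trans j≡ (sym (+-suc (toℕ e) _))))
    where
    j≡ = sym (m+[n∸m]≡n e<j)

  edge-edge-distance : ∀ {e f} → e ≢ f → toℕ e ≤ toℕ f → IsDist M (inj₂ e) (inj₂ f) (dist (inj₂ e) (inj₂ f))
  edge-edge-distance {e} {f} e≢f e≤f =
    isDist-of-walk (e≢f ∘ inj₂-injective) (edgeWalk _ e f f≡) (cong suc f≡)
    where
    f≡ = sym (m+[n∸m]≡n e≤f)

  distance : ∀ u v → u ≢ v → IsDist M u v (dist u v)
  distance (inj₁ i) (inj₁ j) i≢j with <-cmp (toℕ i) (toℕ j)
  ... | tri< i<j _ _ = vertex-vertex-distance i<j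
  ... | tri≈ _ i≡j _ = ⊥-elim (i≢j (cong inj₁ (Finₚ.toℕ-injective i≡j)))
  ... | tri> _ _ j<i = isDist-flip (vertex-vertex-distance j<i)
  distance (inj₁ i) (inj₂ f) _ with toℕ i ≤? toℕ f
  ... | yes i≤f = vertex-edge-distance i≤f
  ... | no  i≰f = isDist-flip (edge-vertex-distance (≰⇒> i≰f))
  distance (inj₂ e) (inj₁ j) _ with toℕ j ≤? toℕ e
  ... | yes j≤e = isDist-flip (vertex-edge-distance j≤e)
  ... | no  j≰e = edge-vertex-distance (≰⇒> j≰e)
  distance (inj₂ e) (inj₂ f) e≢f with ≤-total (toℕ e) (toℕ f)
  ... | inj₁ e≤f = edge-edge-distance (e≢f ∘ cong inj₂) e≤f
  ... | inj₂ f≤e = isDist-flip (edge-edge-distance (e≢f ∘ cong inj₂ ∘ sym) f≤e)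

  hi≤n : ∀ u → hi (node u) ≤ n
  hi≤n (inj₁ i) = Finₚ.toℕ<n i
  hi≤n (inj₂ e) = ≤-trans (Finₚ.toℕ<n e) (n≤1+n _)

  dist≤n : ∀ u v → dist u v ≤ n
  dist≤n u v = ⊔-lub (≤-trans (m∸n≤m _ (lo (node u))) (hi≤n v)) (≤-trans (m∸n≤m _ (lo (node v))) (hi≤n u))

  dist-pos : ∀ {u v} → u ≢ v → 1 ≤ dist u v
  dist-pos {u} {v} u≢v with dist u v | distance u v u≢v
  ... | zero  | here , _ = ⊥-elim (u≢v refl)
  ... | suc _ | _        = s≤s z≤n

  diameter : IsDiam M n
  diameter = connected , bounded , inj₁ Fin.zero , inj₁ lastVertex , subst (IsDist M _ _) ends-dist (distance _ _ λ ())
    where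
    lastVertex : Fin n
    lastVertex = Fin.fromℕ (suc m)
    ends-dist : dist (inj₁ Fin.zero) (inj₁ lastVertex) ≡ n
    ends-dist = trans (cong (λ t → suc t ⊔ (1 ∸ t)) (Finₚ.toℕ-fromℕ (suc m)))
                      (m≥n⇒m⊔n≡m (≤-trans (m∸n≤m 1 (suc m)) (s≤s z≤n)))
    connected : ∀ u v → ∃[ k ] IsDist M u v k
    connected u v with ≡-dec Finₚ._≟_ Finₚ._≟_ u v
    ... | yes refl = 0 , here , λ _ _ → z≤n
    ... | no  u≢v  = dist u v , distance u v u≢v
    bounded : ∀ u v k → IsDist M u v k → k ≤ n
    bounded u v k d with ≡-dec Finₚ._≟_ Finₚ._≟_ u v
    ... | yes refl = ≤-trans (proj₂ d 0 here) z≤n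
    ... | no  u≢v  = ≤-trans (≤-reflexive (IsDist-unique d (distance u v u≢v))) (dist≤n u v)

  weightOf : Elt → ℕ
  weightOf u = weight n (node u)

  elements : List Elt
  elements = tabulate inj₁ ++ tabulate inj₂

  elements-unique : Unique elements
  elements-unique = Unique.++⁺ (Unique.tabulate⁺ inj₁-injective) (Unique.tabulate⁺ inj₂-injective) disjoint
    where
    disjoint : ∀ {v} → ¬ (v ∈ tabulate inj₁ × v ∈ tabulate inj₂)
    disjoint (p , q) with ∈-tabulate⁻ {f = inj₁} p | ∈-tabulate⁻ {f = inj₂} q
    ... | _ , refl | _ , ()

  length-elements : length elements ≡ n + suc m
  length-elements = trans (length-++ (tabulate {n = n} inj₁))
                          (cong₂ _+_ (length-tabulate {n = n} inj₁) (length-tabulate {n = suc m} inj₂))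

  sum-weightOf-elements : sum (map weightOf elements) ≡ n * n
  sum-weightOf-elements = begin
    sum (map weightOf elements)                                   ≡⟨ cong sum (map-++ weightOf (tabulate inj₁) (tabulate inj₂)) ⟩
    sum (map weightOf (tabulate inj₁) ++ map weightOf (tabulate inj₂))  ≡⟨ sum-++ (map weightOf (tabulate inj₁)) _ ⟩
    sum (map weightOf (tabulate inj₁)) + sum (map weightOf (tabulate inj₂))
      ≡⟨ cong₂ (λ a b → sum a + sum b) (map-tabulate inj₁ weightOf) (map-tabulate inj₂ weightOf) ⟩
    sum (tabulate (weightOf ∘ inj₁)) + sum (tabulate (weightOf ∘ inj₂))
      ≡⟨ cong₂ _+_ (sum-tabulate-toℕ n (weight n ∘ inj₁)) (sum-tabulate-toℕ (suc m) (weight n ∘ inj₂)) ⟩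
    sumBelow n (weight n ∘ inj₁) + sumBelow (suc m) (weight n ∘ inj₂)
      ≡⟨ cong₂ _+_ (sumBelow-cong n (weight-vertex n)) (sumBelow-cong (suc m) (weight-edge m)) ⟩
    sumBelow n (λ i → suc ∣ n - suc (2 * i) ∣) + oddOffsetSum (suc m)
      ≡⟨ cong (_+ oddOffsetSum (suc m)) (sumBelow-suc-pointwise n (λ i → ∣ n - suc (2 * i) ∣)) ⟩
    n + oddOffsetSum n + oddOffsetSum (suc m)                      ≡⟨ +-assoc n _ _ ⟩
    n + (oddOffsetSum n + oddOffsetSum (suc m))                    ≡⟨ cong (n +_) (+-comm (oddOffsetSum n) _) ⟩
    n + (oddOffsetSum (suc m) + oddOffsetSum n)                    ≡⟨ cong (n +_) (oddOffsetSum-consecutive (suc m)) ⟩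
    n * n                                                          ∎
    where open ≡-Reasoning

  module LowerBound (φ : Elt → ℕ) (radio : IsRadioLabeling M n φ) where

    radio-step : ∀ {u v} → u ≢ v → φ u ≤ φ v → 2 * suc n + 2 * φ u ≤ 2 * φ v + (weightOf u + weightOf v)
    radio-step {u} {v} u≢v φu≤φv = begin
      2 * suc n + 2 * φ u                               ≤⟨ +-monoˡ-≤ (2 * φ u) (*-monoʳ-≤ 2 gap) ⟩
      2 * (φ v ∸ φ u + dist u v) + 2 * φ u              ≡⟨ regroup (φ v ∸ φ u) (dist u v) (φ u) ⟩
      2 * (φ v ∸ φ u + φ u) + 2 * dist u v              ≤⟨ +-mono-≤ (≤-reflexive (cong (2 *_) (m∸n+n≡m φu≤φv)))
                                                                    (2*nodeDist≤weight+weight n (node u) (node v)) ⟩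
      2 * φ v + (weightOf u + weightOf v)               ∎
      where
      open ≤-Reasoning
      gap : suc n ≤ φ v ∸ φ u + dist u v
      gap = subst (λ x → suc n ≤ x + dist u v) (m≤n⇒∣m-n∣≡n∸m φu≤φv) (radio u v u≢v _ (distance u v u≢v))
      regroup : ∀ a d f → 2 * (a + d) + 2 * f ≡ 2 * (a + f) + 2 * d
      regroup = solve-∀

    open Sort (On.decTotalOrder ≤-decTotalOrder φ) using (sort; sort-↭; sort-↗)

    span-lower : ∀ s → IsSpan M φ s → n * n ∸ 1 ≤ s
    span-lower s (span , _) with sort elements | sort-↭ elements | sort-↗ elements
    ... | []         | sorted↭ | _ = ⊥-elim (0≢1+n (trans (↭-length sorted↭) length-elements))
    ... | _ ∷ []     | sorted↭ | _ = ⊥-elim (0≢1+n (suc-injective (trans (↭-length sorted↭) length-elements)))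
    ... | x ∷ y ∷ ys | sorted↭ | ascending =
      subst (_≤ s) (sym n*n∸1≡Q) (*-cancelˡ-≤ 2 (+-cancelʳ-≤ _ _ _ doubled))
      where
      open ≤-Reasoning
      c = 2 * suc n
      l = lastOf y ys
      Q = m * m + 4 * m + 3
      n*n∸1≡Q : n * n ∸ 1 ≡ Q
      n*n∸1≡Q = cong (_∸ 1) (square m)
        where
        square : ∀ m → (2 + m) * (2 + m) ≡ suc (m * m + 4 * m + 3)
        square = solve-∀
      unique : Unique (x ∷ y ∷ ys)
      unique = PermSetoid.Unique-resp-↭ (setoid Elt) (↭⇒↭ₛ (↭-sym sorted↭)) elements-unique
      steps : Linked (λ a b → c + 2 * φ a ≤ 2 * φ b + (weightOf a + weightOf b)) (x ∷ y ∷ ys)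
      steps = Linked.zipWith (λ (u≢v , φu≤φv) → radio-step u≢v φu≤φv) (AllPairs⇒Linked unique , ascending)
      x≢l : x ≢ l
      x≢l = All.lookup (AllPairs.head unique) (lastOf-∈ y ys)
      length-tail : length (y ∷ ys) ≡ suc m + suc m
      length-tail = suc-injective (trans (↭-length sorted↭) length-elements)
      total-weight : sum (map weightOf (x ∷ y ∷ ys)) ≡ n * n
      total-weight = trans (sum-↭ (Perm.map⁺ weightOf sorted↭)) sum-weightOf-elements
      ends-weight : 2 ≤ weightOf x + weightOf l
      ends-weight = ≤-trans (*-monoʳ-≤ 2 (dist-pos x≢l)) (2*nodeDist≤weight+weight n (node x) (node l))
      φl≤s+φx : φ l ≤ s + φ x
      φl≤s+φx = ≤-trans (m≤∣m-n∣+n (φ l) (φ x)) (+-monoˡ-≤ (φ x) (span l x))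
      expand : ∀ m f → 2 * (m * m + 4 * m + 3) + (2 * f + 2 * ((2 + m) * (2 + m)))
                      ≡ ((1 + m) + (1 + m)) * (2 * (1 + (2 + m))) + 2 * f + 2
      expand = solve-∀
      regroup : ∀ s f N → 2 * (s + f) + 2 * N ≡ 2 * s + (2 * f + 2 * N)
      regroup = solve-∀
      doubled : 2 * Q + (2 * φ x + 2 * (n * n)) ≤ 2 * s + (2 * φ x + 2 * (n * n))
      doubled = begin
        2 * Q + (2 * φ x + 2 * (n * n))                         ≡⟨ expand m (φ x) ⟩
        (suc m + suc m) * c + 2 * φ x + 2                       ≤⟨ +-monoʳ-≤ _ ends-weight ⟩
        (suc m + suc m) * c + 2 * φ x + (weightOf x + weightOf l) ≡⟨ +-assoc _ (weightOf x) (weightOf l) ⟨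
        (suc m + suc m) * c + 2 * φ x + weightOf x + weightOf l
          ≡⟨ cong (λ L → L * c + 2 * φ x + weightOf x + weightOf l) length-tail ⟨
        length (y ∷ ys) * c + 2 * φ x + weightOf x + weightOf l ≤⟨ telescope φ weightOf c steps ⟩
        2 * φ l + 2 * sum (map weightOf (x ∷ y ∷ ys))
          ≤⟨ +-mono-≤ (*-monoʳ-≤ 2 φl≤s+φx) (≤-reflexive (cong (2 *_) total-weight)) ⟩
        2 * (s + φ x) + 2 * (n * n)                             ≡⟨ regroup s (φ x) (n * n) ⟩
        2 * s + (2 * φ x + 2 * (n * n))                         ∎

  module Scheduled (pos : Elt → ℕ) (at : ℕ → Node) (gap : ℕ → ℕ) (T : ℕ)
                   (at-pos : ∀ u → at (pos u) ≡ node u) (pos≤T : ∀ u → pos u ≤ T)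
                   (gap-consecutive : ∀ t → suc n ≤ gap t + nodeDist (at t) (at (suc t)))
                   (gap-twice : ∀ t → n ≤ gap t + gap (suc t))
                   (first final : Elt) (pos-first : pos first ≡ 0) (pos-final : pos final ≡ T) where

    label : Elt → ℕ
    label u = sumBelow (pos u) gap

    label-skip : ∀ {t t′} → 2 + t ≤ t′ → sumBelow t gap + n ≤ sumBelow t′ gap
    label-skip {t} {t′} 2+t≤t′ = begin
      sumBelow t gap + n                          ≤⟨ +-monoʳ-≤ _ (gap-twice t) ⟩
      sumBelow t gap + (gap t + gap (suc t))      ≡⟨ +-assoc (sumBelow t gap) _ _ ⟨
      sumBelow t gap + gap t + gap (suc t)        ≡⟨ cong₂ _+_ (sumBelow-suc t gap) refl ⟨
      sumBelow (suc t) gap + gap (suc t)          ≡⟨ sumBelow-suc (suc t) gap ⟨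
      sumBelow (2 + t) gap                        ≤⟨ sumBelow-monoˡ gap 2+t≤t′ ⟩
      sumBelow t′ gap                             ∎
      where open ≤-Reasoning

    radio-ordered : ∀ {u v} → u ≢ v → pos u < pos v → suc n ≤ ∣ label u - label v ∣ + dist u v
    radio-ordered {u} {v} u≢v pu<pv with m≤n⇒m<n∨m≡n pu<pv
    ... | inj₂ 1+pu≡pv = subst₂ (λ a b → suc n ≤ a + b) (sym label-difference) nodeDist-at (gap-consecutive (pos u))
      where
      label-difference : ∣ label u - label v ∣ ≡ gap (pos u)
      label-difference = begin
        ∣ label u - label v ∣                             ≡⟨ cong (λ t → ∣ label u - sumBelow t gap ∣) 1+pu≡pv ⟨
        ∣ label u - sumBelow (suc (pos u)) gap ∣          ≡⟨ cong (λ x → ∣ label u - x ∣) (sumBelow-suc (pos u) gap) ⟩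
        ∣ label u - label u + gap (pos u) ∣               ≡⟨ ∣m-m+n∣≡n (label u) _ ⟩
        gap (pos u)                                       ∎
        where open ≡-Reasoning
      nodeDist-at : nodeDist (at (pos u)) (at (suc (pos u))) ≡ dist u v
      nodeDist-at = cong₂ nodeDist (at-pos u) (trans (cong at 1+pu≡pv) (at-pos v))
    ... | inj₁ 1+pu<pv = ≤-trans (≤-reflexive (+-comm 1 n)) (+-mono-≤ n≤difference (dist-pos u≢v))
      where
      lu+n≤lv : label u + n ≤ label v
      lu+n≤lv = label-skip 1+pu<pv
      n≤difference : n ≤ ∣ label u - label v ∣
      n≤difference = ≤-trans (m+n≤o⇒m≤o∸n n (≤-trans (≤-reflexive (+-comm n _)) lu+n≤lv))
                             (≤-trans (m∸n≤∣m-n∣ (label v) (label u)) (≤-reflexive (∣-∣-comm (label v) _)))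

    label-radio : IsRadioLabeling M n label
    label-radio u v u≢v k d = subst (λ k → suc n ≤ ∣ label u - label v ∣ + k) (IsDist-unique (distance u v u≢v) d) ordered
      where
      ordered : suc n ≤ ∣ label u - label v ∣ + dist u v
      ordered with <-cmp (pos u) (pos v)
      ... | tri< pu<pv _ _ = radio-ordered u≢v pu<pv
      ... | tri≈ _ pu≡pv _ = ⊥-elim (u≢v (node-injective (trans (sym (at-pos u)) (trans (cong at pu≡pv) (at-pos v)))))
      ... | tri> _ _ pv<pu = subst₂ (λ a b → suc n ≤ a + b) (∣-∣-comm (label v) (label u))
                                   (nodeDist-comm (node v) (node u)) (radio-ordered (u≢v ∘ sym) pv<pu)

    label-span : IsSpan M label (sumBelow T gap)
    label-span = (λ u v → ≤-trans (∣m-n∣≤m⊔n (label u) (label v)) (⊔-lub (bounded u) (bounded v)))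
               , final , first , trans (cong₂ (λ a b → ∣ sumBelow a gap - sumBelow b gap ∣) pos-final pos-first)
                                       (∣-∣-identityʳ (sumBelow T gap))
      where
      bounded : ∀ u → label u ≤ sumBelow T gap
      bounded u = sumBelow-monoˡ gap (pos≤T u)

    radioNumber : sumBelow T gap ≡ n * n ∸ 1 → IsRadioNumber M (n * n ∸ 1)
    radioNumber span≡ = n , diameter , (label , label-radio , subst (IsSpan M label) span≡ label-span)
                      , λ φ radio → LowerBound.span-lower φ radio

shiftBy : ℕ → Node → Node
shiftBy zero    x = x
shiftBy (suc a) x = shift (shiftBy a x)

shiftBy-vertex : ∀ a i → shiftBy a (inj₁ i) ≡ inj₁ (a + i)
shiftBy-vertex zero    i = refl
shiftBy-vertex (suc a) i = cong shift (shiftBy-vertex a i)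

shiftBy-edge : ∀ a j → shiftBy a (inj₂ j) ≡ inj₂ (a + j)
shiftBy-edge zero    j = refl
shiftBy-edge (suc a) j = cong shift (shiftBy-edge a j)

module Periodic (n : ℕ) (c b₀ b₁ b₂ b₃ : Node) (g₀ g₁ g₂ g₃ : ℕ) where

  block : ℕ → Node
  block 0                             = b₀
  block 1                             = b₁
  block 2                             = b₂
  block 3                             = b₃
  block (suc (suc (suc (suc t))))     = shift (block t)

  blockGap : ℕ → ℕ
  blockGap 0                          = g₀
  blockGap 1                          = g₁
  blockGap 2                          = g₂
  blockGap 3                          = g₃
  blockGap (suc (suc (suc (suc t))))  = blockGap t

  at : ℕ → Node
  at zero    = c
  at (suc t) = block t

  gap : ℕ → ℕ
  gap zero    = n
  gap (suc t) = blockGap t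

  block-periodic : ∀ a r → block (a * 4 + r) ≡ shiftBy a (block r)
  block-periodic zero    r = refl
  block-periodic (suc a) r = cong shift (block-periodic a r)

  blockGap-periodic : ∀ a r → blockGap (a * 4 + r) ≡ blockGap r
  blockGap-periodic zero    r = refl
  blockGap-periodic (suc a) r = blockGap-periodic a r

  sumBelow-blockGap : ∀ a → sumBelow (a * 4) blockGap ≡ a * (g₀ + g₁ + g₂ + g₃)
  sumBelow-blockGap zero    = refl
  sumBelow-blockGap (suc a) =
    trans (cong (λ s → g₀ + (g₁ + (g₂ + (g₃ + s)))) (sumBelow-blockGap a)) (regroup a g₀ g₁ g₂ g₃)
    where
    regroup : ∀ a g₀ g₁ g₂ g₃ →
              g₀ + (g₁ + (g₂ + (g₃ + a * (g₀ + g₁ + g₂ + g₃)))) ≡ suc a * (g₀ + g₁ + g₂ + g₃)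
    regroup = solve-∀

  module _ (c→b₀ : suc n ≤ n + nodeDist c b₀) (b₀→b₁ : suc n ≤ g₀ + nodeDist b₀ b₁)
           (b₁→b₂ : suc n ≤ g₁ + nodeDist b₁ b₂) (b₂→b₃ : suc n ≤ g₂ + nodeDist b₂ b₃)
           (b₃→b₀ : suc n ≤ g₃ + nodeDist b₃ (shift b₀)) where

    blockGap-consecutive : ∀ t → suc n ≤ blockGap t + nodeDist (block t) (block (suc t))
    blockGap-consecutive 0 = b₀→b₁
    blockGap-consecutive 1 = b₁→b₂
    blockGap-consecutive 2 = b₂→b₃
    blockGap-consecutive 3 = b₃→b₀
    blockGap-consecutive (suc (suc (suc (suc t)))) =
      subst (λ d → suc n ≤ blockGap t + d) (sym (nodeDist-shift (block t) (block (suc t)))) (blockGap-consecutive t)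

    gap-consecutive : ∀ t → suc n ≤ gap t + nodeDist (at t) (at (suc t))
    gap-consecutive zero    = c→b₀
    gap-consecutive (suc t) = blockGap-consecutive t

  module _ (g₀₁ : n ≤ g₀ + g₁) (g₁₂ : n ≤ g₁ + g₂) (g₂₃ : n ≤ g₂ + g₃) (g₃₀ : n ≤ g₃ + g₀) where

    blockGap-twice : ∀ t → n ≤ blockGap t + blockGap (suc t)
    blockGap-twice 0                           = g₀₁
    blockGap-twice 1                           = g₁₂
    blockGap-twice 2                           = g₂₃
    blockGap-twice 3                           = g₃₀
    blockGap-twice (suc (suc (suc (suc t))))   = blockGap-twice t

    gap-twice : ∀ t → n ≤ gap t + gap (suc t)
    gap-twice zero    = m≤m+n n g₀
    gap-twice (suc t) = blockGap-twice t

blockPos-mono : ∀ {x y r s} → x < y → r ≤ 4 + s → x * 4 + r ≤ y * 4 + s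
blockPos-mono {x} {y} {r} {s} x<y r≤4+s = begin
  x * 4 + r           ≤⟨ +-monoʳ-≤ (x * 4) r≤4+s ⟩
  x * 4 + (4 + s)     ≡⟨ regroup x s ⟩
  suc x * 4 + s       ≤⟨ +-monoˡ-≤ s (*-monoˡ-≤ 4 x<y) ⟩
  y * 4 + s           ∎
  where
  open ≤-Reasoning
  regroup : ∀ x s → x * 4 + (4 + s) ≡ suc x * 4 + s
  regroup = solve-∀

module EvenSchedule (k : ℕ) where

  K : ℕ
  K = suc k

  open MiddlePath (k + k)
  -- n = 2K; writing v_i for vertices and e_j = v_j v_{j+1}, the order is e_k and then
  -- v_{K+a}, v_a, e_{K+a}, e_a for a = 0, 1, …, with gaps K, K, K + 1, K.
  open Periodic n (inj₂ k) (inj₁ K) (inj₁ 0) (inj₂ K) (inj₂ 0) K K (suc K) K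

  n≡K+K : n ≡ K + K
  n≡K+K = cong suc (sym (+-suc k k))

  3+k+k≡K+1+K : 3 + (k + k) ≡ K + suc K
  3+k+k≡K+1+K = arith k
    where
    arith : ∀ k → 3 + (k + k) ≡ suc k + suc (suc k)
    arith = solve-∀

  c→b₀ : suc n ≤ n + nodeDist (inj₂ k) (inj₁ K)
  c→b₀ = ≤-trans (≤-reflexive (+-comm 1 n)) (+-monoʳ-≤ n (≤-trans (≤-reflexive (sym (m+n∸n≡m 1 k))) (m≤m⊔n _ _)))

  b₀→b₁ : suc n ≤ K + nodeDist (inj₁ K) (inj₁ 0)
  b₀→b₁ = ≤-trans (≤-reflexive 3+k+k≡K+1+K) (+-monoʳ-≤ K (m≤n⊔m (1 ∸ K) (suc K)))

  b₁→b₂ : suc n ≤ K + nodeDist (inj₁ 0) (inj₂ K)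
  b₁→b₂ = ≤-trans (≤-reflexive 3+k+k≡K+1+K) (+-monoʳ-≤ K (m≤m⊔n (suc K) (1 ∸ suc K)))

  b₂→b₃ : suc n ≤ suc K + nodeDist (inj₂ K) (inj₂ 0)
  b₂→b₃ = ≤-trans (≤-reflexive (trans 3+k+k≡K+1+K (+-comm K (suc K)))) (+-monoʳ-≤ (suc K) (m≤n⊔m (1 ∸ suc K) K))

  b₃→b₀ : suc n ≤ K + nodeDist (inj₂ 0) (shift (inj₁ K))
  b₃→b₀ = ≤-trans (≤-reflexive 3+k+k≡K+1+K) (+-monoʳ-≤ K (m≤m⊔n (suc K) (1 ∸ suc K)))

  posNode : Node → ℕ
  posNode (inj₁ a) with K ≤? a
  ... | yes _ = suc ((a ∸ K) * 4 + 0)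
  ... | no  _ = suc (a * 4 + 1)
  posNode (inj₂ b) with K ≤? b
  ... | yes _ = suc ((b ∸ K) * 4 + 2)
  ... | no  _ with b ≟ k
  ...   | yes _ = 0
  ...   | no  _ = suc (b * 4 + 3)

  at-posNode : ∀ x → at (posNode x) ≡ x
  at-posNode (inj₁ a) with K ≤? a
  ... | yes K≤a = trans (block-periodic (a ∸ K) 0) (trans (shiftBy-vertex (a ∸ K) K) (cong inj₁ (m∸n+n≡m K≤a)))
  ... | no  _   = trans (block-periodic a 1) (trans (shiftBy-vertex a 0) (cong inj₁ (+-identityʳ a)))
  at-posNode (inj₂ b) with K ≤? b
  ... | yes K≤b = trans (block-periodic (b ∸ K) 2) (trans (shiftBy-edge (b ∸ K) K) (cong inj₂ (m∸n+n≡m K≤b)))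
  ... | no  _ with b ≟ k
  ...   | yes b≡k = cong inj₂ (sym b≡k)
  ...   | no  _   = trans (block-periodic b 3) (trans (shiftBy-edge b 0) (cong inj₂ (+-identityʳ b)))

  T : ℕ
  T = suc (k * 4 + 1)

  posNode≤T : ∀ u → posNode (node u) ≤ T
  posNode≤T (inj₁ i) with K ≤? toℕ i
  ... | yes _ = s≤s (+-mono-≤ (*-monoˡ-≤ 4 (m≤n+o⇒m∸n≤o (toℕ i) K (s≤s⁻¹ (Finₚ.toℕ<n i)))) z≤n)
  ... | no  i≱K = s≤s (+-monoˡ-≤ 1 (*-monoˡ-≤ 4 (s≤s⁻¹ (≰⇒> i≱K))))
  posNode≤T (inj₂ e) with K ≤? toℕ e
  ... | yes K≤e = s≤s (blockPos-mono (+-cancelʳ-≤ K _ _ (≤-trans (≤-reflexive (cong suc (m∸n+n≡m K≤e)))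
                         (≤-trans (Finₚ.toℕ<n e) (≤-reflexive (sym (+-suc k k)))))) (s≤s (s≤s z≤n)))
  ... | no  e≱K with toℕ e ≟ k
  ...   | yes _   = z≤n
  ...   | no  e≢k = s≤s (blockPos-mono (≤∧≢⇒< (s≤s⁻¹ (≰⇒> e≱K)) e≢k) (m≤n+m 3 2))

  k<1+k+k : k < suc (k + k)
  k<1+k+k = s≤s (m≤m+n k k)

  first final : Elt
  first = inj₂ (fromℕ< k<1+k+k)
  final = inj₁ (fromℕ< (m<n⇒m<1+n k<1+k+k))

  pos-first : posNode (node first) ≡ 0
  pos-first = trans (cong (posNode ∘ inj₂) (Finₚ.toℕ-fromℕ< k<1+k+k)) centre
    where
    centre : posNode (inj₂ k) ≡ 0
    centre with K ≤? k
    ... | yes K≤k = ⊥-elim (1+n≰n K≤k)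
    ... | no  _ with k ≟ k
    ...   | yes _   = refl
    ...   | no  k≢k = ⊥-elim (k≢k refl)

  pos-final : posNode (node final) ≡ T
  pos-final = trans (cong (posNode ∘ inj₁) (Finₚ.toℕ-fromℕ< (m<n⇒m<1+n k<1+k+k))) end
    where
    end : posNode (inj₁ k) ≡ T
    end with K ≤? k
    ... | yes K≤k = ⊥-elim (1+n≰n K≤k)
    ... | no  _   = refl

  span : sumBelow T gap ≡ n * n ∸ 1
  span = begin
    n + sumBelow (k * 4 + 1) blockGap                               ≡⟨ cong (n +_) (sumBelow-+ (k * 4) 1 blockGap) ⟩
    n + (sumBelow (k * 4) blockGap + (blockGap (k * 4 + 0) + 0))
      ≡⟨ cong₂ (λ a b → n + (a + (b + 0))) (sumBelow-blockGap k) (blockGap-periodic k 0) ⟩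
    n + (k * (K + K + suc K + K) + (K + 0))                         ≡⟨ cong (_∸ 1) (square k) ⟨
    n * n ∸ 1                                                       ∎
    where
    open ≡-Reasoning
    square : ∀ k → (2 + (k + k)) * (2 + (k + k))
                   ≡ suc (2 + (k + k) + (k * ((1 + k) + (1 + k) + (2 + k) + (1 + k)) + ((1 + k) + 0)))
    square = solve-∀

  open Scheduled (posNode ∘ node) at gap T (at-posNode ∘ node) posNode≤T
                 (gap-consecutive c→b₀ b₀→b₁ b₁→b₂ b₂→b₃ b₃→b₀)
                 (gap-twice (≤-reflexive n≡K+K) (≤-trans (≤-reflexive n≡K+K) (+-monoʳ-≤ K (n≤1+n K)))
                            (≤-trans (≤-reflexive n≡K+K) (+-monoˡ-≤ K (n≤1+n K))) (≤-reflexive n≡K+K))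
                 first final pos-first pos-final

  radioNumber-even : IsRadioNumber M (n * n ∸ 1)
  radioNumber-even = radioNumber span

module OddSchedule (k : ℕ) where

  K : ℕ
  K = suc k

  open MiddlePath (suc (k + k))
  -- n = 2K + 1; the order is v_K and then e_{K+a}, v_a, v_{K+1+a}, e_a for a = 0, 1, …,
  -- with gaps K + 1, K, K + 1, K + 1.
  open Periodic n (inj₁ K) (inj₂ K) (inj₁ 0) (inj₁ (suc K)) (inj₂ 0) (suc K) K (suc K) (suc K)

  4+k+k≡2K+2 : 4 + (k + k) ≡ suc K + suc K
  4+k+k≡2K+2 = arith k
    where
    arith : ∀ k → 4 + (k + k) ≡ (2 + k) + (2 + k)
    arith = solve-∀

  n≡1+K+K : n ≡ suc K + K
  n≡1+K+K = arith k
    where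
    arith : ∀ k → 3 + (k + k) ≡ (2 + k) + (1 + k)
    arith = solve-∀

  c→b₀ : suc n ≤ n + nodeDist (inj₁ K) (inj₂ K)
  c→b₀ = ≤-trans (≤-reflexive (+-comm 1 n)) (+-monoʳ-≤ n (≤-trans (≤-reflexive (sym (m+n∸n≡m 1 k))) (m≤m⊔n _ _)))

  b₀→b₁ : suc n ≤ suc K + nodeDist (inj₂ K) (inj₁ 0)
  b₀→b₁ = ≤-trans (≤-reflexive 4+k+k≡2K+2) (+-monoʳ-≤ (suc K) (m≤n⊔m (1 ∸ suc K) (suc K)))

  b₁→b₂ : suc n ≤ K + nodeDist (inj₁ 0) (inj₁ (suc K))
  b₁→b₂ = ≤-trans (≤-reflexive (arith k)) (+-monoʳ-≤ K (m≤m⊔n (suc (suc K)) (1 ∸ suc K)))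
    where
    arith : ∀ k → 4 + (k + k) ≡ (1 + k) + (3 + k)
    arith = solve-∀

  b₂→b₃ : suc n ≤ suc K + nodeDist (inj₁ (suc K)) (inj₂ 0)
  b₂→b₃ = ≤-trans (≤-reflexive 4+k+k≡2K+2) (+-monoʳ-≤ (suc K) (m≤n⊔m (1 ∸ suc K) (suc K)))

  b₃→b₀ : suc n ≤ suc K + nodeDist (inj₂ 0) (shift (inj₂ K))
  b₃→b₀ = ≤-trans (≤-reflexive 4+k+k≡2K+2) (+-monoʳ-≤ (suc K) (m≤m⊔n (suc K) (1 ∸ suc (suc K))))

  posNode : Node → ℕ
  posNode (inj₁ a) with suc K ≤? a
  ... | yes _ = suc ((a ∸ suc K) * 4 + 2)
  ... | no  _ with a ≟ K
  ...   | yes _ = 0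
  ...   | no  _ = suc (a * 4 + 1)
  posNode (inj₂ b) with K ≤? b
  ... | yes _ = suc ((b ∸ K) * 4 + 0)
  ... | no  _ = suc (b * 4 + 3)

  at-posNode : ∀ x → at (posNode x) ≡ x
  at-posNode (inj₁ a) with suc K ≤? a
  ... | yes 1+K≤a = trans (block-periodic (a ∸ suc K) 2)
                           (trans (shiftBy-vertex (a ∸ suc K) (suc K)) (cong inj₁ (m∸n+n≡m 1+K≤a)))
  ... | no  _ with a ≟ K
  ...   | yes a≡K = cong inj₁ (sym a≡K)
  ...   | no  _   = trans (block-periodic a 1) (trans (shiftBy-vertex a 0) (cong inj₁ (+-identityʳ a)))
  at-posNode (inj₂ b) with K ≤? b
  ... | yes K≤b = trans (block-periodic (b ∸ K) 0) (trans (shiftBy-edge (b ∸ K) K) (cong inj₂ (m∸n+n≡m K≤b)))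
  ... | no  _   = trans (block-periodic b 3) (trans (shiftBy-edge b 0) (cong inj₂ (+-identityʳ b)))

  T : ℕ
  T = suc (k * 4 + 3)

  posNode≤T : ∀ u → posNode (node u) ≤ T
  posNode≤T (inj₁ i) with suc K ≤? toℕ i
  ... | yes _ = s≤s (+-mono-≤ (*-monoˡ-≤ 4 (m≤n+o⇒m∸n≤o (toℕ i) (suc K) (s≤s⁻¹ (Finₚ.toℕ<n i)))) (n≤1+n 2))
  ... | no  i≱1+K with toℕ i ≟ K
  ...   | yes _   = z≤n
  ...   | no  i≢K = s≤s (+-mono-≤ (*-monoˡ-≤ 4 (s≤s⁻¹ (≤∧≢⇒< (s≤s⁻¹ (≰⇒> i≱1+K)) i≢K))) (s≤s z≤n))
  posNode≤T (inj₂ e) with K ≤? toℕ e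
  ... | yes _   = s≤s (+-mono-≤ (*-monoˡ-≤ 4 (m≤n+o⇒m∸n≤o (toℕ e) K (s≤s⁻¹ (Finₚ.toℕ<n e)))) z≤n)
  ... | no  e≱K = s≤s (+-monoˡ-≤ 3 (*-monoˡ-≤ 4 (s≤s⁻¹ (≰⇒> e≱K))))

  K<n : K < n
  K<n = s≤s (s≤s (≤-trans (m≤m+n k k) (n≤1+n _)))

  k<2+k+k : k < suc (suc (k + k))
  k<2+k+k = s≤s (≤-trans (m≤m+n k k) (n≤1+n _))

  first final : Elt
  first = inj₁ (fromℕ< K<n)
  final = inj₂ (fromℕ< k<2+k+k)

  pos-first : posNode (node first) ≡ 0
  pos-first = trans (cong (posNode ∘ inj₁) (Finₚ.toℕ-fromℕ< K<n)) centre
    where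
    centre : posNode (inj₁ K) ≡ 0
    centre with suc K ≤? K
    ... | yes 1+K≤K = ⊥-elim (1+n≰n 1+K≤K)
    ... | no  _ with K ≟ K
    ...   | yes _   = refl
    ...   | no  K≢K = ⊥-elim (K≢K refl)

  pos-final : posNode (node final) ≡ T
  pos-final = trans (cong (posNode ∘ inj₂) (Finₚ.toℕ-fromℕ< k<2+k+k)) end
    where
    end : posNode (inj₂ k) ≡ T
    end with K ≤? k
    ... | yes K≤k = ⊥-elim (1+n≰n K≤k)
    ... | no  _   = refl

  span : sumBelow T gap ≡ n * n ∸ 1
  span = begin
    n + sumBelow (k * 4 + 3) blockGap                               ≡⟨ cong (n +_) (sumBelow-+ (k * 4) 3 blockGap) ⟩
    n + (sumBelow (k * 4) blockGap + sumBelow 3 (λ i → blockGap (k * 4 + i)))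
      ≡⟨ cong₂ (λ a b → n + (a + b)) (sumBelow-blockGap k) (sumBelow-cong 3 (blockGap-periodic k)) ⟩
    n + (k * (suc K + K + suc K + suc K) + (suc K + (K + (suc K + 0))))  ≡⟨ cong (_∸ 1) (square k) ⟨
    n * n ∸ 1                                                       ∎
    where
    open ≡-Reasoning
    square : ∀ k → (3 + (k + k)) * (3 + (k + k))
                   ≡ suc (3 + (k + k) + (k * ((2 + k) + (1 + k) + (2 + k) + (2 + k)) + ((2 + k) + ((1 + k) + ((2 + k) + 0)))))
    square = solve-∀

  open Scheduled (posNode ∘ node) at gap T (at-posNode ∘ node) posNode≤T
                 (gap-consecutive c→b₀ b₀→b₁ b₁→b₂ b₂→b₃ b₃→b₀)
                 (gap-twice (≤-reflexive n≡1+K+K) (≤-reflexive (trans n≡1+K+K (+-comm (suc K) K)))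
                            (≤-trans (≤-reflexive n≡1+K+K) (+-monoʳ-≤ (suc K) (n≤1+n K)))
                            (≤-trans (≤-reflexive n≡1+K+K) (+-monoʳ-≤ (suc K) (n≤1+n K))))
                 first final pos-first pos-final

  radioNumber-odd : IsRadioNumber M (n * n ∸ 1)
  radioNumber-odd = radioNumber span

radioNumber-singleton : IsRadioNumber (middleGraph (pathGraph 1)) 0
radioNumber-singleton = 0 , diameter , ((λ _ → 0) , radio , span) , λ _ _ _ _ → z≤n
  where
  M₁ = middleGraph (pathGraph 1)
  diameter : IsDiam M₁ 0
  diameter = (λ { (inj₁ Fin.zero) (inj₁ Fin.zero) → 0 , here , λ _ _ → z≤n })
           , (λ { (inj₁ Fin.zero) (inj₁ Fin.zero) k d → proj₂ d 0 here })
           , inj₁ Fin.zero , inj₁ Fin.zero , here , λ _ _ → z≤n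
  radio : IsRadioLabeling M₁ 0 (λ _ → 0)
  radio (inj₁ Fin.zero) (inj₁ Fin.zero) u≢u = ⊥-elim (u≢u refl)
  span : IsSpan M₁ (λ _ → 0) 0
  span = (λ _ _ → z≤n) , inj₁ Fin.zero , inj₁ Fin.zero , refl

mainTheorem1 : (n k : ℕ) → 1 ≤ n →
    (n ≡ 2 * k → IsRadioNumber (middleGraph (pathGraph n)) (4 * (k * k) ∸ 1))
    × (n ≡ 2 * k + 1 → IsRadioNumber (middleGraph (pathGraph n)) (4 * k * (k + 1)))
mainTheorem1 n zero 1≤n =
    (λ n≡0 → ⊥-elim (1+n≰n (subst (1 ≤_) n≡0 1≤n)))
  , (λ n≡1 → subst (λ n → IsRadioNumber (middleGraph (pathGraph n)) 0) (sym n≡1) radioNumber-singleton)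
mainTheorem1 n (suc k) _ =
    (λ n≡ → subst₂ RadioNumberOfPath (sym (trans n≡ (even-size k))) (cong (_∸ 1) (even-square k))
                   (EvenSchedule.radioNumber-even k))
  , (λ n≡ → subst₂ RadioNumberOfPath (sym (trans n≡ (odd-size k))) (cong (_∸ 1) (odd-square k))
                   (OddSchedule.radioNumber-odd k))
  where
  RadioNumberOfPath : ℕ → ℕ → Set
  RadioNumberOfPath n = IsRadioNumber (middleGraph (pathGraph n))
  even-size : ∀ k → 2 * suc k ≡ 2 + (k + k)
  even-size = solve-∀
  even-square : ∀ k → (2 + (k + k)) * (2 + (k + k)) ≡ 4 * (suc k * suc k)
  even-square = solve-∀
  odd-size : ∀ k → 2 * suc k + 1 ≡ 3 + (k + k)
  odd-size = solve-∀
  odd-square : ∀ k → (3 + (k + k)) * (3 + (k + k)) ≡ 1 + 4 * suc k * (suc k + 1)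
  odd-square = solve-∀
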